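{- There exist unidirectional, edge-labeled Eulerian graphs $G_1,G_2$ with closed Eulerian trails such that neither of the following linear programs (on their alignment graph $(V,E,\delta)$) has an integral optimal solution: (LP1) minimize $\sum_{e\in E}\delta(e)x_e$ over $x\in\mathbb{R}^{E}_{\ge 0}$ subject to (i) for every vertex $u\in V$, $\sum_{e\text{ entering }u}x_e-\sum_{e\text{ leaving }u}x_e=0$, and (ii) for $i=1,2$ and every $f\in E_i$, $\sum_{e\in E}x_eI_i(e,f)=1$; (LP2) minimize $\sum_{e\in E}\delta(e)x_e$ over $x\in\mathbb{R}^{E}_{\ge 0}$, $y\in\mathbb{R}^{T}$ subject to $x=x^{init}+[\partial]y$.
   Context: A unidirectional, edge-labeled Eulerian graph is a connected directed multigraph $G=(V,E,\ell,\Sigma)$ with edge labels $\ell:E\to\Sigma$, having an Eulerian trail, with all edges between the same pair of vertices pointing in the same direction. For $G_i=(V_i,E_i,\ell_i,\Sigma)$, the alignment graph has vertex set $V=V_1\times V_2$ and edge multiset $E$: for $f_1=(u_1,v_1)\in E_1$, $w\in V_2$ a vertical edge $\mathrm{ver}(f_1,w)=[(u_1,w),(v_1,w)]$ of cost 1; for $w\in V_1$, $f_2=(u_2,v_2)\in E_2$ a horizontal edge $\mathrm{hor}(w,f_2)=[(w,u_2),(w,v_2)]$ of cost 1; for $f_1\in E_1,f_2\in E_2$ a diagonal edge $\mathrm{dia}(f_1,f_2)=[(u_1,u_2),(v_1,v_2)]$ of cost $\delta=0$ if $\ell_1(f_1)=\ell_2(f_2)$ and 1 otherwise. $I_1(e,f)=1$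 iff $e$ is $\mathrm{ver}(f,\cdot)$ or $\mathrm{dia}(f,\cdot)$; $I_2(e,f)=1$ iff $e$ is $\mathrm{hor}(\cdot,f)$ or $\mathrm{dia}(\cdot,f)$; otherwise 0. $T$ contains, for each $f_1=(u_1,v_1)\in E_1,f_2=(u_2,v_2)\in E_2$, the oriented triangles $\sigma=[(u_1,u_2),(v_1,u_2),(v_1,v_2)]$ and $\sigma'=[(u_1,u_2),(u_1,v_2),(v_1,v_2)]$; $[\partial]\in\mathbb{Z}^{E\times T}$ has column $\sigma$ equal to $\mathbf{1}_{\mathrm{ver}(f_1,u_2)}+\mathbf{1}_{\mathrm{hor}(v_1,f_2)}-\mathbf{1}_{\mathrm{dia}(f_1,f_2)}$ and column $\sigma'$ equal to $\mathbf{1}_{\mathrm{hor}(u_1,f_2)}+\mathbf{1}_{\mathrm{ver}(f_1,v_2)}-\mathbf{1}_{\mathrm{dia}(f_1,f_2)}$. For fixed $s_1\in V_1,s_2\in V_2$, $x^{init}_e=1$ if $e=\mathrm{ver}(f_1,s_2)$ for some $f_1\in E_1$ or $e=\mathrm{hor}(s_1,f_2)$ for some $f_2\in E_2$, and $0$ otherwise. -}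

module Defs where

open import Data.Nat using (ℕ)
open import Data.Fin using (Fin)
open import Data.Fin.Properties renaming (_≟_ to _≟ᶠ_)
open import Data.Integer using (ℤ)
open import Data.Rational using (ℚ; 0ℚ; 1ℚ; _+_; _*_; _-_; -_; _≤_; _/_)
open import Data.Product.Properties using (≡-dec)
import Data.Nat
open import Data.List using (List; []; _∷_; allFin; head; last; map; concatMap; foldr; _++_)
open import Data.List.Relation.Unary.Linked using (Linked)
open import Data.List.Relation.Binary.Permutation.Propositional using (_↭_)
open import Data.Maybe using (just)
open import Data.Product using (Σ; _×_; _,_; ∃)
open import Relation.Binary.PropositionalEquality using (_≡_)
open import Relation.Nullary using (Dec; yes; no; ¬_)

-- The alphabet Σ is taken to be ℕ (any finite alphabet embeds into it).

record Graph : Set where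
  field
    nV  : ℕ
    nE  : ℕ
    src : Fin nE → Fin nV
    tgt : Fin nE → Fin nV
    lab : Fin nE → ℕ
open Graph public

data Reach (G : Graph) : Fin (nV G) → Fin (nV G) → Set where
  here : ∀ {u} → Reach G u u
  fwd  : ∀ {u} (e : Fin (nE G)) → Reach G (tgt G e) u → Reach G (src G e) u
  bwd  : ∀ {u} (e : Fin (nE G)) → Reach G (src G e) u → Reach G (tgt G e) u

Connected : Graph → Set
Connected G = ∀ u v → Reach G u v

-- all edges between the same pair of vertices point in the same direction
Unidirectional : Graph → Set
Unidirectional G = ∀ e e' → src G e ≡ tgt G e' → tgt G e ≡ src G e' → src G e ≡ tgt G e

ClosedEulerianTrail : (G : Graph) → List (Fin (nE G)) → Set
ClosedEulerianTrail G ts =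
  (ts ↭ allFin (nE G)) ×
  Linked (λ a b → tgt G a ≡ src G b) ts ×
  (∀ h l → head ts ≡ just h → last ts ≡ just l → tgt G l ≡ src G h)

UEGraphClosed : Graph → Set
UEGraphClosed G = Connected G × Unidirectional G × ∃ (ClosedEulerianTrail G)

module Alignment (G₁ G₂ : Graph) where

  AVertex : Set
  AVertex = Fin (nV G₁) × Fin (nV G₂)

  data AEdge : Set where
    ver : Fin (nE G₁) → Fin (nV G₂) → AEdge
    hor : Fin (nV G₁) → Fin (nE G₂) → AEdge
    dia : Fin (nE G₁) → Fin (nE G₂) → AEdge

  allAE : List AEdge
  allAE = concatMap (λ f → map (ver f) (allFin (nV G₂))) (allFin (nE G₁))
       ++ concatMap (λ w → map (hor w) (allFin (nE G₂))) (allFin (nV G₁))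
       ++ concatMap (λ f → map (dia f) (allFin (nE G₂))) (allFin (nE G₁))

  tail : AEdge → AVertex
  tail (ver f w) = src G₁ f , w
  tail (hor w f) = w , src G₂ f
  tail (dia f g) = src G₁ f , src G₂ g

  headV : AEdge → AVertex
  headV (ver f w) = tgt G₁ f , w
  headV (hor w f) = w , tgt G₂ f
  headV (dia f g) = tgt G₁ f , tgt G₂ g

  [_] : ∀ {P : Set} → Dec P → ℚ
  [ yes _ ] = 1ℚ
  [ no _ ]  = 0ℚ

  δ : AEdge → ℚ
  δ (ver _ _) = 1ℚ
  δ (hor _ _) = 1ℚ
  δ (dia f g) with lab G₁ f Data.Nat.≟ lab G₂ g
  ... | yes _ = 0ℚ
  ... | no _  = 1ℚ

  I₁ : AEdge → Fin (nE G₁) → ℚ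
  I₁ (ver f' _) f = [ f' ≟ᶠ f ]
  I₁ (hor _ _)  f = 0ℚ
  I₁ (dia f' _) f = [ f' ≟ᶠ f ]

  I₂ : AEdge → Fin (nE G₂) → ℚ
  I₂ (ver _ _)  f = 0ℚ
  I₂ (hor _ f') f = [ f' ≟ᶠ f ]
  I₂ (dia _ f') f = [ f' ≟ᶠ f ]

  _≟V_ : (u v : AVertex) → Dec (u ≡ v)
  _≟V_ = ≡-dec _≟ᶠ_ _≟ᶠ_

  sumℚ : ∀ {A : Set} → List A → (A → ℚ) → ℚ
  sumℚ xs f = foldr (λ a r → f a + r) 0ℚ xs

  cost : (AEdge → ℚ) → ℚ
  cost x = sumℚ allAE (λ e → δ e * x e)

  NonNeg : (AEdge → ℚ) → Set
  NonNeg x = ∀ e → 0ℚ ≤ x e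

  Feasible₁ : (AEdge → ℚ) → Set
  Feasible₁ x =
    NonNeg x ×
    (∀ u → sumℚ allAE (λ e → x e * ([ headV e ≟V u ] - [ tail e ≟V u ])) ≡ 0ℚ) ×
    (∀ f → sumℚ allAE (λ e → x e * I₁ e f) ≡ 1ℚ) ×
    (∀ f → sumℚ allAE (λ e → x e * I₂ e f) ≡ 1ℚ)

  -- oriented triangles: tri f₁ f₂ is σ, tri' f₁ f₂ is σ'
  data Tri : Set where
    tri  : Fin (nE G₁) → Fin (nE G₂) → Tri
    tri' : Fin (nE G₁) → Fin (nE G₂) → Tri

  allT : List Tri
  allT = concatMap (λ f → map (tri f) (allFin (nE G₂))) (allFin (nE G₁))
      ++ concatMap (λ f → map (tri' f) (allFin (nE G₂))) (allFin (nE G₁))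

  ∂ : AEdge → Tri → ℚ
  ∂ (ver f w) (tri f₁ f₂)  = [ f ≟ᶠ f₁ ] * [ w ≟ᶠ src G₂ f₂ ]
  ∂ (hor w g) (tri f₁ f₂)  = [ w ≟ᶠ tgt G₁ f₁ ] * [ g ≟ᶠ f₂ ]
  ∂ (dia f g) (tri f₁ f₂)  = - ([ f ≟ᶠ f₁ ] * [ g ≟ᶠ f₂ ])
  ∂ (ver f w) (tri' f₁ f₂) = [ f ≟ᶠ f₁ ] * [ w ≟ᶠ tgt G₂ f₂ ]
  ∂ (hor w g) (tri' f₁ f₂) = [ w ≟ᶠ src G₁ f₁ ] * [ g ≟ᶠ f₂ ]
  ∂ (dia f g) (tri' f₁ f₂) = - ([ f ≟ᶠ f₁ ] * [ g ≟ᶠ f₂ ])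

  xinit : Fin (nV G₁) → Fin (nV G₂) → AEdge → ℚ
  xinit s₁ s₂ (ver _ w) = [ w ≟ᶠ s₂ ]
  xinit s₁ s₂ (hor w _) = [ w ≟ᶠ s₁ ]
  xinit s₁ s₂ (dia _ _) = 0ℚ

  Feasible₂ : Fin (nV G₁) → Fin (nV G₂) → (AEdge → ℚ) → (Tri → ℚ) → Set
  Feasible₂ s₁ s₂ x y =
    NonNeg x × (∀ e → x e ≡ xinit s₁ s₂ e + sumℚ allT (λ t → ∂ e t * y t))

  IsInt : ℚ → Set
  IsInt q = ∃ λ (z : ℤ) → q ≡ z / 1

  Optimal₁ : (AEdge → ℚ) → Set
  Optimal₁ x = Feasible₁ x × (∀ x' → Feasible₁ x' → cost x ≤ cost x')

  Optimal₂ : Fin (nV G₁) → Fin (nV G₂) → (AEdge → ℚ) → (Tri → ℚ) → Set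
  Optimal₂ s₁ s₂ x y =
    Feasible₂ s₁ s₂ x y × (∀ x' y' → Feasible₂ s₁ s₂ x' y' → cost x ≤ cost x')

  HasIntegralOptimum₁ : Set
  HasIntegralOptimum₁ = ∃ λ x → (∀ e → IsInt (x e)) × Optimal₁ x

  HasIntegralOptimum₂ : Fin (nV G₁) → Fin (nV G₂) → Set
  HasIntegralOptimum₂ s₁ s₂ =
    Σ (AEdge → ℚ) λ x → Σ (Tri → ℚ) λ y →
      (∀ e → IsInt (x e)) × (∀ t → IsInt (y t)) × Optimal₂ s₁ s₂ x y

-- Both graphs are a 3-cycle 0 → 1 → 2 → 0 with a loop at 0; the closed trails read aabb and baba.
-- The LP has a half-integral solution of cost 1.  Split δ = w + (δ - w) with an integral weight w;
-- weak LP duality, with explicit dual certificates, gives Σ w x ≥ ½ and Σ (δ - w) x ≥ ⅓ for every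
-- nonnegative solution x of the equality constraints of LP1.  For integral x the first sum is an
-- integer, hence ≥ 1, so the cost of x is ≥ 4/3 > 1 (a Chvátal–Gomory cut).  LP2 reduces to LP1:
-- x^init satisfies the equality constraints of LP1 and every column of [∂] lies in their kernel.
module Submission where

open import Defs
open import Data.Fin using (Fin)
open import Data.Product using (Σ; _×_)
open import Relation.Nullary using (¬_)

open import Data.Nat using (ℕ; s≤s; z≤n)
open import Data.Fin using (zero; suc)
import Data.Fin.Properties as Fin
open import Data.Integer using (ℤ; +[1+_]; -[1+_]; +≤+)
import Data.Integer as ℤ
import Data.Integer.Properties as ℤ
open import Data.Rational using (ℚ; 0ℚ; 1ℚ; ½; _+_; _*_; _-_; _≤_; _<_; _/_; toℚᵘ; nonNegative)
open import Data.Rational.Properties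
import Data.Rational.Unnormalised as ℚᵘ
import Data.Rational.Unnormalised.Properties as ℚᵘ
open import Data.Rational.Solver using (module +-*-Solver)
open import Data.List using (List; []; _∷_; foldr; map; concatMap; allFin; _++_)
open import Data.List.Relation.Unary.Linked using ([-]; _∷_)
open import Data.List.Relation.Binary.Permutation.Propositional using (↭-refl)
open import Data.Vec using (Vec; lookup; _∷_; [])
open import Data.Product using (∃; _,_; proj₁)
open import Relation.Nullary using (Dec; yes; no)
open import Relation.Nullary.Decidable using (from-yes; _→-dec_)
open import Relation.Binary.PropositionalEquality using (_≡_; refl; sym; trans; cong; cong₂)
open import Relation.Binary.PropositionalEquality.Properties using (module ≡-Reasoning)

private variable
  A B : Set

-- Alignment.sumℚ, without fixing two graphs.
∑ : List A → (A → ℚ) → ℚ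
∑ xs f = foldr (λ a s → f a + s) 0ℚ xs

∑-cong : (xs : List A) {f g : A → ℚ} → (∀ a → f a ≡ g a) → ∑ xs f ≡ ∑ xs g
∑-cong []       f≡g = refl
∑-cong (a ∷ xs) f≡g = cong₂ _+_ (f≡g a) (∑-cong xs f≡g)

∑-zero : (xs : List A) → ∑ xs (λ _ → 0ℚ) ≡ 0ℚ
∑-zero []       = refl
∑-zero (a ∷ xs) = trans (cong (0ℚ +_) (∑-zero xs)) (+-identityˡ 0ℚ)

∑-+ : (xs : List A) (f g : A → ℚ) → ∑ xs (λ a → f a + g a) ≡ ∑ xs f + ∑ xs g
∑-+ []       f g = sym (+-identityˡ 0ℚ)
∑-+ (a ∷ xs) f g =
  trans (cong ((f a + g a) +_) (∑-+ xs f g)) (interchange (f a) (g a) (∑ xs f) (∑ xs g))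
  where
  open +-*-Solver
  interchange : ∀ p q r s → (p + q) + (r + s) ≡ (p + r) + (q + s)
  interchange = solve 4 (λ p q r s → (p :+ q) :+ (r :+ s) := (p :+ r) :+ (q :+ s)) refl

∑-*ˡ : (xs : List A) (k : ℚ) (f : A → ℚ) → ∑ xs (λ a → k * f a) ≡ k * ∑ xs f
∑-*ˡ []       k f = sym (*-zeroʳ k)
∑-*ˡ (a ∷ xs) k f = trans (cong (k * f a +_) (∑-*ˡ xs k f)) (sym (*-distribˡ-+ k (f a) (∑ xs f)))

∑-*ʳ : (xs : List A) (k : ℚ) (f : A → ℚ) → ∑ xs (λ a → f a * k) ≡ ∑ xs f * k
∑-*ʳ xs k f = trans (∑-cong xs (λ a → *-comm (f a) k)) (trans (∑-*ˡ xs k f) (*-comm k (∑ xs f)))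

∑-mono-≤ : (xs : List A) {f g : A → ℚ} → (∀ a → f a ≤ g a) → ∑ xs f ≤ ∑ xs g
∑-mono-≤ []       f≤g = ≤-refl
∑-mono-≤ (a ∷ xs) f≤g = +-mono-≤ (f≤g a) (∑-mono-≤ xs f≤g)

∑-comm : (xs : List A) (ys : List B) (h : A → B → ℚ) →
         ∑ xs (λ a → ∑ ys (h a)) ≡ ∑ ys (λ b → ∑ xs (λ a → h a b))
∑-comm []       ys h = sym (∑-zero ys)
∑-comm (a ∷ xs) ys h =
  trans (cong (∑ ys (h a) +_) (∑-comm xs ys h)) (sym (∑-+ ys (h a) (λ b → ∑ xs (λ a → h a b))))

∑-split : (xs : List A) (c x v : A → ℚ) →
          ∑ xs (λ a → c a * x a) ≡ ∑ xs (λ a → x a * v a) + ∑ xs (λ a → x a * (c a - v a))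
∑-split xs c x v = trans (∑-cong xs λ a → split (c a) (x a) (v a)) (∑-+ xs (λ a → x a * v a) (λ a → x a * (c a - v a)))
  where
  open +-*-Solver
  split : ∀ c x v → c * x ≡ x * v + x * (c - v)
  split = solve 3 (λ c x v → c :* x := x :* v :+ x :* (c :- v)) refl

-- Alignment.IsInt, without fixing two graphs.
Integral : ℚ → Set
Integral q = ∃ λ (z : ℤ) → q ≡ z / 1

toℚᵘ-/1 : ∀ z → toℚᵘ (z / 1) ℚᵘ.≃ ℚᵘ.mkℚᵘ z 0
toℚᵘ-/1 z = toℚᵘ-fromℚᵘ (ℚᵘ.mkℚᵘ z 0)

integral-+ : ∀ {p q} → Integral p → Integral q → Integral (p + q)
integral-+ (z , refl) (z′ , refl) = z ℤ.+ z′ , toℚᵘ-injective (begin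
  toℚᵘ (z / 1 + z′ / 1)                          ≈⟨ toℚᵘ-homo-+ (z / 1) (z′ / 1) ⟩
  toℚᵘ (z / 1) ℚᵘ.+ toℚᵘ (z′ / 1)                ≈⟨ ℚᵘ.+-cong (toℚᵘ-/1 z) (toℚᵘ-/1 z′) ⟩
  ℚᵘ.mkℚᵘ z 0 ℚᵘ.+ ℚᵘ.mkℚᵘ z′ 0                ≡⟨ cong₂ (λ m n → ℚᵘ.mkℚᵘ (m ℤ.+ n) 0) (ℤ.*-identityʳ z) (ℤ.*-identityʳ z′) ⟩
  ℚᵘ.mkℚᵘ (z ℤ.+ z′) 0                           ≈⟨ ℚᵘ.≃-sym (toℚᵘ-/1 (z ℤ.+ z′)) ⟩
  toℚᵘ ((z ℤ.+ z′) / 1)                          ∎)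
  where open ℚᵘ.≃-Reasoning

integral-* : ∀ {p q} → Integral p → Integral q → Integral (p * q)
integral-* (z , refl) (z′ , refl) = z ℤ.* z′ , toℚᵘ-injective (begin
  toℚᵘ (z / 1 * (z′ / 1))                        ≈⟨ toℚᵘ-homo-* (z / 1) (z′ / 1) ⟩
  toℚᵘ (z / 1) ℚᵘ.* toℚᵘ (z′ / 1)                ≈⟨ ℚᵘ.*-cong (toℚᵘ-/1 z) (toℚᵘ-/1 z′) ⟩
  ℚᵘ.mkℚᵘ (z ℤ.* z′) 0                           ≈⟨ ℚᵘ.≃-sym (toℚᵘ-/1 (z ℤ.* z′)) ⟩
  toℚᵘ ((z ℤ.* z′) / 1)                          ∎)
  where open ℚᵘ.≃-Reasoning

integral-∑ : (xs : List A) {f : A → ℚ} → (∀ a → Integral (f a)) → Integral (∑ xs f)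
integral-∑ []       _        = ℤ.0ℤ , refl
integral-∑ (a ∷ xs) integral = integral-+ (integral a) (integral-∑ xs integral)

integral-round-up : ∀ {q} → Integral q → ½ ≤ q → 1ℚ ≤ q
integral-round-up (z , refl) ½≤q = toℚᵘ-cancel-≤ (ℚᵘ.≤-respʳ-≃ (ℚᵘ.≃-sym (toℚᵘ-/1 z)) (½≤z⇒1≤z z ½≤z))
  where
  ½≤z : toℚᵘ ½ ℚᵘ.≤ ℚᵘ.mkℚᵘ z 0
  ½≤z = ℚᵘ.≤-respʳ-≃ (toℚᵘ-/1 z) (toℚᵘ-mono-≤ ½≤q)
  ½≤z⇒1≤z : ∀ z → toℚᵘ ½ ℚᵘ.≤ ℚᵘ.mkℚᵘ z 0 → toℚᵘ 1ℚ ℚᵘ.≤ ℚᵘ.mkℚᵘ z 0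
  ½≤z⇒1≤z +[1+ n ]  _                   = ℚᵘ.*≤* (+≤+ (s≤s z≤n))
  ½≤z⇒1≤z (ℤ.+ 0)   (ℚᵘ.*≤* (+≤+ ()))
  ½≤z⇒1≤z -[1+ n ]  (ℚᵘ.*≤* ())

module LinearSystem {R E : Set} (rows : List R) (cols : List E) (a : R → E → ℚ) (b : R → ℚ) where

  Solves : (E → ℚ) → Set
  Solves x = ∀ r → ∑ cols (λ e → x e * a r e) ≡ b r

  weak-duality : ∀ {x} → (∀ e → 0ℚ ≤ x e) → Solves x →
                 (u : R → ℚ) {c : E → ℚ} → (∀ e → ∑ rows (λ r → u r * a r e) ≤ c e) →
                 ∑ rows (λ r → u r * b r) ≤ ∑ cols (λ e → x e * c e)
  weak-duality {x} x≥0 Ax≡b u {c} uA≤c = begin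
    ∑ rows (λ r → u r * b r)                                 ≡⟨ ∑-cong rows (λ r → cong (u r *_) (sym (Ax≡b r))) ⟩
    ∑ rows (λ r → u r * ∑ cols (λ e → x e * a r e))          ≡⟨ ∑-cong rows (λ r → sym (∑-*ˡ cols (u r) _)) ⟩
    ∑ rows (λ r → ∑ cols (λ e → u r * (x e * a r e)))        ≡⟨ ∑-comm rows cols (λ r e → u r * (x e * a r e)) ⟩
    ∑ cols (λ e → ∑ rows (λ r → u r * (x e * a r e)))        ≡⟨ ∑-cong cols (λ e → ∑-cong rows (λ r → swap (u r) (x e) (a r e))) ⟩
    ∑ cols (λ e → ∑ rows (λ r → x e * (u r * a r e)))        ≡⟨ ∑-cong cols (λ e → ∑-*ˡ rows (x e) _) ⟩
    ∑ cols (λ e → x e * ∑ rows (λ r → u r * a r e))          ≤⟨ ∑-mono-≤ cols (λ e → *-monoˡ-≤-nonNeg (x e) {{nonNegative (x≥0 e)}} (uA≤c e)) ⟩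
    ∑ cols (λ e → x e * c e)                                 ∎
    where
    open ≤-Reasoning
    open +-*-Solver
    swap : ∀ p q r → p * (q * r) ≡ q * (p * r)
    swap = solve 3 (λ p q r → p :* (q :* r) := q :* (p :* r)) refl

  solves-translate : ∀ {T : Set} (ts : List T) (D : E → T → ℚ) {x₀ x : E → ℚ} (y : T → ℚ) →
                     Solves x₀ → (∀ r t → ∑ cols (λ e → D e t * a r e) ≡ 0ℚ) →
                     (∀ e → x e ≡ x₀ e + ∑ ts (λ t → D e t * y t)) → Solves x
  solves-translate ts D {x₀} {x} y Ax₀≡b AD≡0 x≡x₀+Dy r = begin
    ∑ cols (λ e → x e * a r e)                                           ≡⟨ ∑-cong cols (λ e → trans (cong (_* a r e) (x≡x₀+Dy e)) (*-distribʳ-+ (a r e) (x₀ e) _)) ⟩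
    ∑ cols (λ e → x₀ e * a r e + ∑ ts (λ t → D e t * y t) * a r e)       ≡⟨ ∑-+ cols (λ e → x₀ e * a r e) (λ e → ∑ ts (λ t → D e t * y t) * a r e) ⟩
    ∑ cols (λ e → x₀ e * a r e) + ∑ cols (λ e → ∑ ts (λ t → D e t * y t) * a r e)
                                                                         ≡⟨ cong₂ _+_ (Ax₀≡b r) ADy≡0 ⟩
    b r + 0ℚ                                                             ≡⟨ +-identityʳ (b r) ⟩
    b r                                                                  ∎
    where
    open ≡-Reasoning
    open +-*-Solver
    swap : ∀ p q r → (p * q) * r ≡ q * (p * r)
    swap = solve 3 (λ p q r → (p :* q) :* r := q :* (p :* r)) refl
    ADy≡0 : ∑ cols (λ e → ∑ ts (λ t → D e t * y t) * a r e) ≡ 0ℚ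
    ADy≡0 = begin
      ∑ cols (λ e → ∑ ts (λ t → D e t * y t) * a r e)        ≡⟨ ∑-cong cols (λ e → sym (∑-*ʳ ts (a r e) (λ t → D e t * y t))) ⟩
      ∑ cols (λ e → ∑ ts (λ t → (D e t * y t) * a r e))      ≡⟨ ∑-comm cols ts (λ e t → (D e t * y t) * a r e) ⟩
      ∑ ts (λ t → ∑ cols (λ e → (D e t * y t) * a r e))      ≡⟨ ∑-cong ts (λ t → ∑-cong cols (λ e → swap (D e t) (y t) (a r e))) ⟩
      ∑ ts (λ t → ∑ cols (λ e → y t * (D e t * a r e)))      ≡⟨ ∑-cong ts (λ t → trans (∑-*ˡ cols (y t) _) (cong (y t *_) (AD≡0 r t))) ⟩
      ∑ ts (λ t → y t * 0ℚ)                                  ≡⟨ ∑-cong ts (λ t → *-zeroʳ (y t)) ⟩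
      ∑ ts (λ _ → 0ℚ)                                        ≡⟨ ∑-zero ts ⟩
      0ℚ                                                     ∎

module AlignmentLP (G₁ G₂ : Graph) where
  open Alignment G₁ G₂

  data Constraint : Set where
    flow   : Fin (nV G₁) → Fin (nV G₂) → Constraint
    cover₁ : Fin (nE G₁) → Constraint
    cover₂ : Fin (nE G₂) → Constraint

  constraints : List Constraint
  constraints = concatMap (λ v → map (flow v) (allFin (nV G₂))) (allFin (nV G₁))
             ++ map cover₁ (allFin (nE G₁)) ++ map cover₂ (allFin (nE G₂))

  coefficient : Constraint → AEdge → ℚ
  coefficient (flow v w) e = [ headV e ≟V (v , w) ] - [ tail e ≟V (v , w) ]
  coefficient (cover₁ f) e = I₁ e f
  coefficient (cover₂ f) e = I₂ e f

  rhs : Constraint → ℚ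
  rhs (flow _ _) = 0ℚ
  rhs (cover₁ _) = 1ℚ
  rhs (cover₂ _) = 1ℚ

  open LinearSystem constraints allAE coefficient rhs public

  solves⇒feasible₁ : ∀ {x} → NonNeg x → Solves x → Feasible₁ x
  solves⇒feasible₁ x≥0 Ax≡b =
    x≥0 , (λ (v , w) → Ax≡b (flow v w)) , (λ f → Ax≡b (cover₁ f)) , (λ f → Ax≡b (cover₂ f))

  feasible₁⇒solves : ∀ {x} → Feasible₁ x → Solves x
  feasible₁⇒solves (_ , balanced , covers₁ , covers₂) (flow v w) = balanced (v , w)
  feasible₁⇒solves (_ , balanced , covers₁ , covers₂) (cover₁ f) = covers₁ f
  feasible₁⇒solves (_ , balanced , covers₁ , covers₂) (cover₂ f) = covers₂ f

  all-AEdge? : {P : AEdge → Set} → (∀ e → Dec (P e)) → Dec (∀ e → P e)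
  all-AEdge? P? with Fin.all? (λ f → Fin.all? (λ w → P? (ver f w)))
                   | Fin.all? (λ v → Fin.all? (λ f → P? (hor v f)))
                   | Fin.all? (λ f → Fin.all? (λ g → P? (dia f g)))
  ... | yes pv | yes ph | yes pd = yes λ { (ver f w) → pv f w ; (hor v f) → ph v f ; (dia f g) → pd f g }
  ... | no ¬pv | _      | _      = no λ p → ¬pv λ f w → p (ver f w)
  ... | yes _  | no ¬ph | _      = no λ p → ¬ph λ v f → p (hor v f)
  ... | yes _  | yes _  | no ¬pd = no λ p → ¬pd λ f g → p (dia f g)

  all-Tri? : {P : Tri → Set} → (∀ t → Dec (P t)) → Dec (∀ t → P t)
  all-Tri? P? with Fin.all? (λ f → Fin.all? (λ g → P? (tri f g)))
                 | Fin.all? (λ f → Fin.all? (λ g → P? (tri' f g)))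
  ... | yes pσ | yes pσ′ = yes λ { (tri f g) → pσ f g ; (tri' f g) → pσ′ f g }
  ... | no ¬pσ | _       = no λ p → ¬pσ λ f g → p (tri f g)
  ... | yes _  | no ¬pσ′ = no λ p → ¬pσ′ λ f g → p (tri' f g)

  all-Constraint? : {P : Constraint → Set} → (∀ r → Dec (P r)) → Dec (∀ r → P r)
  all-Constraint? P? with Fin.all? (λ v → Fin.all? (λ w → P? (flow v w)))
                        | Fin.all? (λ f → P? (cover₁ f))
                        | Fin.all? (λ f → P? (cover₂ f))
  ... | yes pf | yes p₁ | yes p₂ = yes λ { (flow v w) → pf v w ; (cover₁ f) → p₁ f ; (cover₂ f) → p₂ f }
  ... | no ¬pf | _      | _      = no λ p → ¬pf λ v w → p (flow v w)
  ... | yes _  | no ¬p₁ | _      = no λ p → ¬p₁ λ f → p (cover₁ f)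
  ... | yes _  | yes _  | no ¬p₂ = no λ p → ¬p₂ λ f → p (cover₂ f)

-- Numeric literals at types ℤ and ℚ from here on (earlier they would block the arity argument of the ring solver).
open import Agda.Builtin.FromNat using (Number; fromNat)
open import Agda.Builtin.FromNeg using (Negative)
open import Data.Unit.Base using (⊤; tt)
import Data.Nat.Literals
import Data.Integer.Literals
import Data.Rational.Literals

instance
  unit : ⊤
  unit = tt
  ℕ-number : Number ℕ
  ℕ-number = Data.Nat.Literals.number
  ℤ-number : Number ℤ
  ℤ-number = Data.Integer.Literals.number
  ℤ-negative : Negative ℤ
  ℤ-negative = Data.Integer.Literals.negative
  ℚ-number : Number ℚ
  ℚ-number = Data.Rational.Literals.number
  ℚ-negative : Negative ℚ
  ℚ-negative = Data.Rational.Literals.negative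

srcT tgtT : Fin 4 → Fin 3
srcT zero                   = zero
srcT (suc zero)             = zero
srcT (suc (suc zero))       = suc zero
srcT (suc (suc (suc zero))) = suc (suc zero)
tgtT zero                   = zero
tgtT (suc zero)             = suc zero
tgtT (suc (suc zero))       = suc (suc zero)
tgtT (suc (suc (suc zero))) = zero

loopTriangle : (Fin 4 → ℕ) → Graph
loopTriangle ℓ = record { nV = 3 ; nE = 4 ; src = srcT ; tgt = tgtT ; lab = ℓ }

loopTriangle-connected : ∀ ℓ → Connected (loopTriangle ℓ)
loopTriangle-connected ℓ = reach
  where
  e₁ e₂ e₃ : Fin 4
  e₁ = suc zero
  e₂ = suc (suc zero)
  e₃ = suc (suc (suc zero))
  reach : Connected (loopTriangle ℓ)
  reach zero             zero             = here
  reach zero             (suc zero)       = fwd e₁ here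
  reach zero             (suc (suc zero)) = fwd e₁ (fwd e₂ here)
  reach (suc zero)       zero             = fwd e₂ (fwd e₃ here)
  reach (suc zero)       (suc zero)       = here
  reach (suc zero)       (suc (suc zero)) = fwd e₂ here
  reach (suc (suc zero)) zero             = fwd e₃ here
  reach (suc (suc zero)) (suc zero)       = fwd e₃ (fwd e₁ here)
  reach (suc (suc zero)) (suc (suc zero)) = here

loopTriangle-unidirectional : ∀ ℓ → Unidirectional (loopTriangle ℓ)
loopTriangle-unidirectional ℓ = from-yes (Fin.all? λ e → Fin.all? λ e′ →
  (srcT e Fin.≟ tgtT e′) →-dec (tgtT e Fin.≟ srcT e′) →-dec (srcT e Fin.≟ tgtT e))

loopTriangle-UEGraphClosed : ∀ ℓ → UEGraphClosed (loopTriangle ℓ)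
loopTriangle-UEGraphClosed ℓ =
  loopTriangle-connected ℓ , loopTriangle-unidirectional ℓ ,
  (allFin 4 , ↭-refl , (refl ∷ refl ∷ refl ∷ [-]) , λ { _ _ refl refl → refl })

aabb baba : Fin 4 → ℕ
aabb i = lookup (0 ∷ 0 ∷ 1 ∷ 1 ∷ []) i
baba i = lookup (1 ∷ 0 ∷ 1 ∷ 0 ∷ []) i

G₁ G₂ : Graph
G₁ = loopTriangle aabb
G₂ = loopTriangle baba

s : Fin 3
s = zero

open Alignment G₁ G₂
open AlignmentLP G₁ G₂

x½ : AEdge → ℚ
x½ (ver (suc (suc (suc zero))) (suc (suc zero))) = ½
x½ (ver _ _)                                     = 0ℚ
x½ (hor zero (suc (suc zero)))                   = ½
x½ (hor _ _)                                     = 0ℚ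
x½ (dia f g) = lookup (lookup support f) g
  where
  support : Vec (Vec ℚ 4) 4
  support = (0 ∷ ½ ∷ 0 ∷ ½ ∷ [])
          ∷ (0 ∷ ½ ∷ 0 ∷ ½ ∷ [])
          ∷ (½ ∷ 0 ∷ ½ ∷ 0 ∷ [])
          ∷ (½ ∷ 0 ∷ 0 ∷ 0 ∷ [])
          ∷ []

y½ : Tri → ℚ
y½ (tri f g) = lookup (lookup table f) g
  where
  table : Vec (Vec ℚ 4) 4
  table = (0 ∷ -1 ∷ -1 / 2 ∷ -1 / 2 ∷ [])
        ∷ (0 ∷ -1 ∷ -1 / 2 ∷ -1 / 2 ∷ [])
        ∷ (-1 / 2 ∷ -1 ∷ -1 ∷ -1 / 2 ∷ [])
        ∷ (-1 ∷ -1 ∷ -1 ∷ -1 / 2 ∷ [])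
        ∷ []
y½ (tri' f g) = lookup (lookup table f) g
  where
  table : Vec (Vec ℚ 4) 4
  table = (0 ∷ ½ ∷ ½ ∷ 0 ∷ [])
        ∷ (0 ∷ ½ ∷ ½ ∷ 0 ∷ [])
        ∷ (0 ∷ 1 ∷ ½ ∷ ½ ∷ [])
        ∷ (½ ∷ 1 ∷ 1 ∷ ½ ∷ [])
        ∷ []

x½-feasible₁ : Feasible₁ x½
x½-feasible₁ = solves⇒feasible₁
  (from-yes (all-AEdge? λ e → 0ℚ ≤? x½ e))
  (from-yes (all-Constraint? λ r → ∑ allAE (λ e → x½ e * coefficient r e) ≟ rhs r))

x½-feasible₂ : Feasible₂ s s x½ y½
x½-feasible₂ = proj₁ x½-feasible₁ ,
  from-yes (all-AEdge? λ e → x½ e ≟ xinit s s e + ∑ allT (λ t → ∂ e t * y½ t))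

x½-cost : cost x½ ≡ 1ℚ
x½-cost = refl

feasible₂⇒solves : ∀ {x} y → Feasible₂ s s x y → Solves x
feasible₂⇒solves y (_ , x≡xinit+∂y) =
  solves-translate allT ∂ {xinit s s} y xinit-solves ∂-columns-in-kernel x≡xinit+∂y
  where
  xinit-solves : Solves (xinit s s)
  xinit-solves = from-yes (all-Constraint? λ r → ∑ allAE (λ e → xinit s s e * coefficient r e) ≟ rhs r)
  ∂-columns-in-kernel : ∀ r t → ∑ allAE (λ e → ∂ e t * coefficient r e) ≡ 0ℚ
  ∂-columns-in-kernel = from-yes (all-Constraint? λ r → all-Tri? λ t → ∑ allAE (λ e → ∂ e t * coefficient r e) ≟ 0ℚ)

-- Weight 1 on the vertical edges and on the diagonals pairing an a-edge of G₁ with a b-edge of G₂.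
w : AEdge → ℤ
w (ver _ _) = 1
w (hor _ _) = 0
w (dia f g) = lookup (lookup table f) g
  where
  table : Vec (Vec ℤ 4) 4
  table = (1 ∷ 0 ∷ 1 ∷ 0 ∷ [])
        ∷ (1 ∷ 0 ∷ 1 ∷ 0 ∷ [])
        ∷ (0 ∷ 0 ∷ 0 ∷ 0 ∷ [])
        ∷ (0 ∷ 0 ∷ 0 ∷ 0 ∷ [])
        ∷ []

w-cost : (AEdge → ℚ) → ℚ
w-cost x = ∑ allAE (λ e → x e * (w e / 1))

rest-cost : (AEdge → ℚ) → ℚ
rest-cost x = ∑ allAE (λ e → x e * (δ e - w e / 1))

cost-split : ∀ x → cost x ≡ w-cost x + rest-cost x
cost-split x = ∑-split allAE δ x (λ e → w e / 1)

dual : Vec (Vec ℚ 3) 3 → Vec ℚ 4 → Vec ℚ 4 → Constraint → ℚ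
dual flowᵤ cover₁ᵤ cover₂ᵤ (flow i j) = lookup (lookup flowᵤ i) j
dual flowᵤ cover₁ᵤ cover₂ᵤ (cover₁ f) = lookup cover₁ᵤ f
dual flowᵤ cover₁ᵤ cover₂ᵤ (cover₂ f) = lookup cover₂ᵤ f

w-dual : Constraint → ℚ
w-dual = dual ((1 ∷ 2 ∷ 2 ∷ []) ∷ (0 ∷ 1 ∷ ½ ∷ []) ∷ (½ ∷ 2 ∷ 1 ∷ []) ∷ [])
              (1 ∷ 2 ∷ 0 ∷ 0 ∷ [])
              (-1 / 2 ∷ -2 ∷ 0 ∷ 0 ∷ [])

rest-dual : Constraint → ℚ
rest-dual = dual ((4 / 3 ∷ 0 ∷ 2 / 3 ∷ []) ∷ (2 ∷ 2 / 3 ∷ 1 ∷ []) ∷ (5 / 3 ∷ 2 / 3 ∷ 2 / 3 ∷ []) ∷ [])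
                 (-2 / 3 ∷ -4 / 3 ∷ 0 ∷ 0 ∷ [])
                 (1 / 3 ∷ 2 ∷ 0 ∷ 0 ∷ [])

w-cost-≥½ : ∀ {x} → (∀ e → 0ℚ ≤ x e) → Solves x → ½ ≤ w-cost x
w-cost-≥½ x≥0 Ax≡b = weak-duality x≥0 Ax≡b w-dual
  (from-yes (all-AEdge? λ e → ∑ constraints (λ r → w-dual r * coefficient r e) ≤? w e / 1))

rest-cost-≥⅓ : ∀ {x} → (∀ e → 0ℚ ≤ x e) → Solves x → 1 / 3 ≤ rest-cost x
rest-cost-≥⅓ x≥0 Ax≡b = weak-duality x≥0 Ax≡b rest-dual
  (from-yes (all-AEdge? λ e → ∑ constraints (λ r → rest-dual r * coefficient r e) ≤? δ e - w e / 1))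

integral-solution-cost : ∀ {x} → (∀ e → 0ℚ ≤ x e) → Solves x → (∀ e → Integral (x e)) → cost x½ < cost x
integral-solution-cost {x} x≥0 Ax≡b x-integral = begin-strict
  cost x½                         ≡⟨ x½-cost ⟩
  1ℚ                              <⟨ from-yes (1ℚ <? 1ℚ + 1 / 3) ⟩
  1ℚ + 1 / 3                      ≤⟨ +-mono-≤ (integral-round-up w-cost-integral (w-cost-≥½ x≥0 Ax≡b)) (rest-cost-≥⅓ x≥0 Ax≡b) ⟩
  w-cost x + rest-cost x          ≡⟨ sym (cost-split x) ⟩
  cost x                          ∎
  where
  open ≤-Reasoning
  w-cost-integral : Integral (w-cost x)
  w-cost-integral = integral-∑ allAE (λ e → integral-* (x-integral e) (w e , refl))

not-optimal : ∀ {x} → (∀ e → 0ℚ ≤ x e) → Solves x → (∀ e → Integral (x e)) → ¬ cost x ≤ cost x½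
not-optimal x≥0 Ax≡b x-integral x≤x½ = <-irrefl refl (<-≤-trans (integral-solution-cost x≥0 Ax≡b x-integral) x≤x½)

theorem9 : Σ Graph λ G₁ → Σ Graph λ G₂ →
    Σ (Fin (nV G₁)) λ s₁ → Σ (Fin (nV G₂)) λ s₂ →
      UEGraphClosed G₁ × UEGraphClosed G₂ ×
      ¬ Alignment.HasIntegralOptimum₁ G₁ G₂ ×
      ¬ Alignment.HasIntegralOptimum₂ G₁ G₂ s₁ s₂
theorem9 =
  G₁ , G₂ , s , s , loopTriangle-UEGraphClosed aabb , loopTriangle-UEGraphClosed baba ,
  (λ (x , x-integral , feasible , optimal) →
     not-optimal (proj₁ feasible) (feasible₁⇒solves feasible) x-integral (optimal x½ x½-feasible₁)) ,
  (λ (x , y , x-integral , _ , feasible , optimal) →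
     not-optimal (proj₁ feasible) (feasible₂⇒solves y feasible) x-integral (optimal x½ y½ x½-feasible₂))
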